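{- Let $\mathtt{At}$ be a countable set of atomic formulas and $\Phi_0$ the set of Boolean formulas over $\mathtt{At}$. The modal axiom schema $$\big(\neg\square\neg\phi\wedge B(\phi>\psi)\big)\rightarrow \neg B(\phi>\neg\psi)\qquad(\phi,\psi\in\Phi_0)$$ corresponds to the following property of Kripke-Lewis frames $\langle S,\mathcal B,f\rangle$: $$(P\ast5)\qquad \forall s\in S,\ \forall E\in 2^S\setminus\{\varnothing\},\ \exists s'\in\mathcal B(s) \text{ such that } f(s',E)\neq\varnothing.$$ That is: (1) the schema is valid on every frame satisfying $(P\ast5)$, and (2) on every frame violating $(P\ast5)$ the schema is not valid.
   Context: $\Phi_0$ is built from $\mathtt{At}$ using $\neg$ and $\vee$ (with $\rightarrow,\wedge,\leftrightarrow$ defined as usual). A Kripke-Lewis frame is a triple $\langle S,\mathcal B,f\rangle$ where $S$ is a set of states, $\mathcal B\subseteq S\times S$ is a serial relation, $\mathcal B(s)=\{s':s\mathcal Bs'\}$, and $f:S\times(2^S\setminus\{\varnothing\})\to 2^S$ is an arbitrary function (no further properties assumed). A model is a frame together with a valuation $V:\mathtt{At}\to 2^S$. Truth at a state $s$: $s\models p$ iff $s\in V(p)$ for atoms; $\neg,\vee$ classical; $\Vert\phi\Vert=\{s:s\models\phi\}$. For $\phi\in\Phi_0$, $s\models\square\phi$ iff $\Vert\phi\Vert=S$. For $\phi,\psi\in\Phi_0$, $s\models\phi>\psi$ iff either $\Vert\phi\Vert=\varnothing$, or $\Vert\phi\Vert\neq\varnothing$ and $f(s,\Vert\phi\Vert)\subseteq\Vert\psi\Vert$.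 For $\phi$ a Boolean combination of formulas of $\Phi_0$ and conditionals $\alpha>\beta$ ($\alpha,\beta\in\Phi_0$), $s\models B\phi$ iff $\mathcal B(s)\subseteq\Vert\phi\Vert$. A schema is valid on a frame if every instance is true at every state of every model based on that frame. -}

module Defs where

open import Level using (0ℓ)
open import Data.Nat using (ℕ)
open import Data.Empty using (⊥)
open import Data.Sum using (_⊎_)
open import Data.Product using (Σ; _×_)
open import Relation.Nullary using (¬_)

At : Set
At = ℕ

data Φ₀ : Set where
  atom : At → Φ₀
  ¬₀_  : Φ₀ → Φ₀
  _∨₀_ : Φ₀ → Φ₀ → Φ₀

-- Formulas that may appear under B : Boolean combinations of Φ₀-formulas
-- and conditionals α > β with α, β ∈ Φ₀.
data Φ₁ : Set where
  base  : Φ₀ → Φ₁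
  _>₁_  : Φ₀ → Φ₀ → Φ₁
  ¬₁_   : Φ₁ → Φ₁
  _∨₁_  : Φ₁ → Φ₁ → Φ₁

data Φ : Set where
  lift : Φ₁ → Φ
  □_   : Φ₀ → Φ
  B_   : Φ₁ → Φ
  ¬_′  : Φ → Φ
  _∨′_ : Φ → Φ → Φ

_∧′_ : Φ → Φ → Φ
a ∧′ b = ¬ ((¬ a ′) ∨′ (¬ b ′)) ′

_⇒′_ : Φ → Φ → Φ
a ⇒′ b = (¬ a ′) ∨′ b

Subset : Set → Set₁
Subset S = S → Set

Empty : {S : Set} → Subset S → Set
Empty {S} E = (s : S) → ¬ E s

_⊆_ : {S : Set} → Subset S → Subset S → Set
_⊆_ {S} E F = (s : S) → E s → F s

SameSubset : {S : Set} → Subset S → Subset S → Set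
SameSubset {S} E F = (s : S) → (E s → F s) × (F s → E s)

-- Kripke–Lewis frame ⟨S, ℬ, f⟩.  f is given on all subsets; its values on
-- the empty set are never consulted.  Since subsets are predicates, f is
-- required to depend only on the subset denoted (extensionality), as a
-- function on 2^S does.
record Frame : Set₁ where
  field
    S       : Set
    ℬ       : S → S → Set
    serial  : (s : S) → Σ S (ℬ s)
    f       : S → Subset S → Subset S
    f-ext   : (s : S) (E F : Subset S) → SameSubset E F →
              SameSubset (f s E) (f s F)

module _ (F : Frame) where
  open Frame F

  Valuation : Set₁
  Valuation = At → Subset S

  _,_⊨₀_ : Valuation → S → Φ₀ → Set
  V , s ⊨₀ atom p  = V p s
  V , s ⊨₀ (¬₀ φ)  = ¬ (V , s ⊨₀ φ)
  V , s ⊨₀ (φ ∨₀ ψ) = (V , s ⊨₀ φ) ⊎ (V , s ⊨₀ ψ)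

  ‖_‖₀ : Φ₀ → Valuation → Subset S
  ‖ φ ‖₀ V s = V , s ⊨₀ φ

  _,_⊨₁_ : Valuation → S → Φ₁ → Set
  V , s ⊨₁ base φ   = V , s ⊨₀ φ
  V , s ⊨₁ (φ >₁ ψ) = Empty (‖ φ ‖₀ V)
                      ⊎ ((¬ Empty (‖ φ ‖₀ V)) × (f s (‖ φ ‖₀ V) ⊆ ‖ ψ ‖₀ V))
  V , s ⊨₁ (¬₁ φ)   = ¬ (V , s ⊨₁ φ)
  V , s ⊨₁ (φ ∨₁ ψ) = (V , s ⊨₁ φ) ⊎ (V , s ⊨₁ ψ)

  _,_⊨_ : Valuation → S → Φ → Set
  V , s ⊨ lift φ    = V , s ⊨₁ φ
  V , s ⊨ (□ φ)     = (t : S) → V , t ⊨₀ φ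
  V , s ⊨ (B φ)     = (t : S) → ℬ s t → V , t ⊨₁ φ
  V , s ⊨ (¬ φ ′)   = ¬ (V , s ⊨ φ)
  V , s ⊨ (φ ∨′ ψ)  = (V , s ⊨ φ) ⊎ (V , s ⊨ ψ)

schema : Φ₀ → Φ₀ → Φ
schema φ ψ = ((¬ (□ (¬₀ φ)) ′) ∧′ (B (φ >₁ ψ))) ⇒′ (¬ (B (φ >₁ (¬₀ ψ))) ′)

ValidSchema : Frame → Set₁
ValidSchema F = (V : Valuation F) (s : Frame.S F) (φ ψ : Φ₀) → _,_⊨_ F V s (schema φ ψ)

P*5 : Frame → Set₁
P*5 F = (s : S) (E : Subset S) → ¬ Empty E →
        Σ S (λ s′ → ℬ s s′ × ¬ Empty (f s′ E))
  where open Frame F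

{-# OPTIONS --safe #-}
module Submission where

-- If φ is satisfiable, (P*5) gives a B-accessible state s′ selecting a
-- nonempty f(s′, ‖φ‖); any selected point would satisfy both ψ and ¬ψ, so
-- B(φ > ψ) and B(φ > ¬ψ) cannot hold together.  Conversely, if every
-- B-accessible state of s selects ∅ for some nonempty E, let every atom
-- denote E: then ¬□¬p holds and p > p, p > ¬p hold vacuously throughout
-- ℬ(s), refuting the instance φ = ψ = p at s.  Excluded middle is used to
-- read the material implication and to extract the witness of (P*5).

open import Defs
open import Level using (0ℓ)
open import Data.Empty using (⊥; ⊥-elim)
open import Data.Nat using (zero)
open import Data.Product using (_×_; _,_; Σ)
open import Data.Sum using (inj₁; inj₂)
open import Function using (_∘_)
open import Relation.Nullary using (¬_; yes; no)
open import Relation.Nullary.Decidable using (decidable-stable)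
open import Axiom.ExcludedMiddle using (ExcludedMiddle)

module _ (F : Frame) where
  open Frame F

  infix 4 _⊨[_]_ _⊨₁[_]_

  _⊨[_]_ : Valuation F → S → Φ → Set
  V ⊨[ s ] φ = _,_⊨_ F V s φ

  _⊨₁[_]_ : Valuation F → S → Φ₁ → Set
  V ⊨₁[ s ] φ = _,_⊨₁_ F V s φ

  ‖_‖ : Φ₀ → Valuation F → Subset S
  ‖ φ ‖ = ‖_‖₀ F φ

  module _ (V : Valuation F) (φ : Φ₀) where

    schema-intro : ExcludedMiddle 0ℓ → (s : S) (ψ : Φ₀) →
                   (¬ Empty (‖ φ ‖ V) → V ⊨[ s ] B (φ >₁ ψ) → V ⊨[ s ] B (φ >₁ (¬₀ ψ)) → ⊥) →
                   V ⊨[ s ] schema φ ψ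
    schema-intro lem s ψ refute with lem {P = V ⊨[ s ] B (φ >₁ (¬₀ ψ))}
    ... | no ¬Bφ>¬ψ  = inj₂ ¬Bφ>¬ψ
    ... | yes Bφ>¬ψ = inj₁ λ premises →
      premises (inj₁ λ φ≢∅ → premises (inj₂ λ Bφ>ψ → refute φ≢∅ Bφ>ψ Bφ>¬ψ))

    schema-elim : (s : S) (ψ : Φ₀) → V ⊨[ s ] schema φ ψ →
                  ¬ Empty (‖ φ ‖ V) → V ⊨[ s ] B (φ >₁ ψ) → V ⊨[ s ] B (φ >₁ (¬₀ ψ)) → ⊥
    schema-elim s ψ (inj₁ ¬premises) φ≢∅ Bφ>ψ _ =
      ¬premises λ { (inj₁ φ≡∅) → φ≡∅ φ≢∅ ; (inj₂ ¬Bφ>ψ) → ¬Bφ>ψ Bφ>ψ }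
    schema-elim s ψ (inj₂ ¬Bφ>¬ψ) _ _ Bφ>¬ψ = ¬Bφ>¬ψ Bφ>¬ψ

    ⊨>⇒f⊆ : {t : S} (ψ : Φ₀) → ¬ Empty (‖ φ ‖ V) →
            V ⊨₁[ t ] (φ >₁ ψ) → f t (‖ φ ‖ V) ⊆ ‖ ψ ‖ V
    ⊨>⇒f⊆ ψ φ≢∅ (inj₁ φ≡∅)      = ⊥-elim (φ≢∅ φ≡∅)
    ⊨>⇒f⊆ ψ φ≢∅ (inj₂ (_ , f⊆ψ)) = f⊆ψ

    B>-consistent : {s : S} (ψ : Φ₀) → ¬ Empty (‖ φ ‖ V) →
                    Σ S (λ s′ → ℬ s s′ × ¬ Empty (f s′ (‖ φ ‖ V))) →
                    V ⊨[ s ] B (φ >₁ ψ) → V ⊨[ s ] B (φ >₁ (¬₀ ψ)) → ⊥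
    B>-consistent ψ φ≢∅ (s′ , ss′ , f≢∅) Bφ>ψ Bφ>¬ψ = f≢∅ λ u u∈f →
      ⊨>⇒f⊆ (¬₀ ψ) φ≢∅ (Bφ>¬ψ s′ ss′) u u∈f (⊨>⇒f⊆ ψ φ≢∅ (Bφ>ψ s′ ss′) u u∈f)

    B>-vacuous : {s : S} (ψ : Φ₀) → ¬ Empty (‖ φ ‖ V) →
                 ((t : S) → ℬ s t → Empty (f t (‖ φ ‖ V))) →
                 V ⊨[ s ] B (φ >₁ ψ)
    B>-vacuous ψ φ≢∅ f≡∅ t st = inj₂ (φ≢∅ , λ u u∈f → ⊥-elim (f≡∅ t st u u∈f))

  P*5⇒valid : ExcludedMiddle 0ℓ → P*5 F → ValidSchema F
  P*5⇒valid lem p*5 V s φ ψ =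
    schema-intro V φ lem s ψ λ φ≢∅ → B>-consistent V φ ψ φ≢∅ (p*5 s (‖ φ ‖ V) φ≢∅)

  valid⇒P*5 : ExcludedMiddle 0ℓ → ValidSchema F → P*5 F
  valid⇒P*5 lem valid s E E≢∅ = decidable-stable lem λ noLiveSuccessor →
    let f≡∅ : (t : S) → ℬ s t → Empty (f t E)
        f≡∅ t st u u∈f = noLiveSuccessor (t , st , λ fE≡∅ → fE≡∅ u u∈f)
    in schema-elim V p s p (valid V s p p) E≢∅
         (B>-vacuous V p p E≢∅ f≡∅) (B>-vacuous V p (¬₀ p) E≢∅ f≡∅)
    where
    V : Valuation F
    V _ = E
    p : Φ₀
    p = atom zero

proposition4 : ExcludedMiddle 0ℓ → ExcludedMiddle (Level.suc 0ℓ) →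
    (F : Frame) → (P*5 F → ValidSchema F) × (¬ P*5 F → ¬ ValidSchema F)
proposition4 lem _ F = P*5⇒valid F lem , λ ¬P*5 → ¬P*5 ∘ valid⇒P*5 F lem
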